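{- The functor $\mathrm{Low} : \mathbf{FrmBisim} \to \mathbf{CABAOBisim}$ is full: every bisimulatory relation $Q : (\mathcal{P}(X), \Box_R) \to (\mathcal{P}(Y), \Box_S)$ equals $\mathrm{Low}(T)$ for some bisimulation $T$ from $(X,R)$ to $(Y,S)$.
   Context: Kripke frame: $(X,R)$ with $R \subseteq X\times X$. $Q\subseteq X\times Y$ is a simulation if $x\mathrel{Q} y$, $x\mathrel{R} x'$ imply some $y'$ with $y\mathrel{S} y'$, $x'\mathrel{Q} y'$; a cosimulation if its converse is a simulation; a bisimulation if both. $\mathbf{FrmBisim}$: frames and bisimulations. $\mathrm{Low}$ sends $(X,R)$ to $(\mathcal{P}(X),\Box_R)$, $\Box_R(A)=\{w\mid\forall v.\ w\mathrel{R} v\Rightarrow v\in A\}$ (left adjoint $\Diamond^{ - }_R(A)=\{w\mid\exists v\in A.\ v\mathrel{R} w\}$), and $Q$ to $\mathrm{Low}(Q)$: $A\mathrel{\mathrm{Low}(Q)} B$ iff $\forall a\in A.\ \exists b\in B.\ a\mathrel{Q} b$. A CABAO is a complete atomic Boolean algebra with meet-preserving $\Box$, left adjoint $\Diamond^{ - }$. A relation $Q$ between CABAs is directionally atomic if a bimodule ($p'\sqsubseteq p\mathrel{Q} q\sqsubseteq q'\Rightarrow p'\mathrel{Q} q'$), left-disjunctive ($a_i\mathrel{Q} b$ for all $i$ implies $\bigsqcup_i a_i\mathrel{Q} b$), atomic-founded (atom $a$, $a\mathrel{Q} b$ implies $a\mathrel{Q} b'$ for some atom $b'\sqsubseteq b$).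 Its variant $Q^{\circ}$: $b'\mathrel{Q^{\circ}} b$ iff every atom $a'\sqsubseteq b'$ has an atom $a\sqsubseteq b$ with $a\mathrel{Q} a'$. $Q:(\mathcal{B},\Box_{\mathcal{B}})\to(\mathcal{B}',\Box_{\mathcal{B}'})$ is bisimulatory if directionally atomic, $A\mathrel{Q}\Box_{\mathcal{B}'}B$ implies $\Diamond^{ - }_{\mathcal{B}}A\mathrel{Q} B$, and $B\mathrel{Q^{\circ}}\Box_{\mathcal{B}}A$ implies $\Diamond^{ - }_{\mathcal{B}'}B\mathrel{Q^{\circ}} A$. $\mathbf{CABAOBisim}$: CABAOs and bisimulatory relations. -}

module Defs where

open import Level using (0ℓ)
open import Data.Product using (Σ; ∃; _×_; _,_)
open import Data.Sum using (_⊎_)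
open import Relation.Nullary using (¬_)
open import Relation.Binary.Core using (Rel; REL)
open import Relation.Unary using (Pred; _⊆_; _∈_)
open import Function.Bundles using (_⇔_)

𝒫 : Set → Set₁
𝒫 X = Pred X 0ℓ

-- Kripke frames are (X , R) with R : Rel X 0ℓ.

IsSimulation : {X Y : Set} → Rel X 0ℓ → Rel Y 0ℓ → REL X Y 0ℓ → Set
IsSimulation {X} {Y} R S Q =
  ∀ (x x' : X) (y : Y) → Q x y → R x x' → Σ Y λ y' → S y y' × Q x' y'

converse : {X Y : Set} → REL X Y 0ℓ → REL Y X 0ℓ
converse Q y x = Q x y

IsCosimulation : {X Y : Set} → Rel X 0ℓ → Rel Y 0ℓ → REL X Y 0ℓ → Set
IsCosimulation R S Q = IsSimulation S R (converse Q)

IsBisimulation : {X Y : Set} → Rel X 0ℓ → Rel Y 0ℓ → REL X Y 0ℓ → Set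
IsBisimulation R S Q = IsSimulation R S Q × IsCosimulation R S Q

□ : {X : Set} → Rel X 0ℓ → 𝒫 X → 𝒫 X
□ {X} R A w = ∀ (v : X) → R w v → A v

◇⁻ : {X : Set} → Rel X 0ℓ → 𝒫 X → 𝒫 X
◇⁻ {X} R A w = Σ X λ v → A v × R v w

Low : {X Y : Set} → REL X Y 0ℓ → 𝒫 X → 𝒫 Y → Set
Low {X} {Y} Q A B = ∀ (a : X) → A a → Σ Y λ b → B b × Q a b

IsBottom : {X : Set} → 𝒫 X → Set
IsBottom {X} A = ∀ (x : X) → ¬ A x

IsAtom : {X : Set} → 𝒫 X → Set₁
IsAtom {X} a = ¬ IsBottom a × (∀ (b : 𝒫 X) → b ⊆ a → IsBottom b ⊎ a ⊆ b)

⋁ : {X I : Set} → (I → 𝒫 X) → 𝒫 X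
⋁ {X} {I} f x = Σ I λ i → f i x

IsBimodule : {X Y : Set} → (𝒫 X → 𝒫 Y → Set) → Set₁
IsBimodule Q = ∀ p' p q q' → p' ⊆ p → Q p q → q ⊆ q' → Q p' q'

IsLeftDisjunctive : {X Y : Set} → (𝒫 X → 𝒫 Y → Set) → Set₁
IsLeftDisjunctive {X} {Y} Q =
  ∀ (I : Set) (a : I → 𝒫 X) (b : 𝒫 Y) → (∀ i → Q (a i) b) → Q (⋁ a) b

IsAtomicFounded : {X Y : Set} → (𝒫 X → 𝒫 Y → Set) → Set₁
IsAtomicFounded {X} {Y} Q =
  ∀ (a : 𝒫 X) (b : 𝒫 Y) → IsAtom a → Q a b →
    Σ (𝒫 Y) λ b' → IsAtom b' × b' ⊆ b × Q a b'

IsDirectionallyAtomic : {X Y : Set} → (𝒫 X → 𝒫 Y → Set) → Set₁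
IsDirectionallyAtomic Q = IsBimodule Q × IsLeftDisjunctive Q × IsAtomicFounded Q

_° : {X Y : Set} → (𝒫 X → 𝒫 Y → Set) → 𝒫 Y → 𝒫 X → Set₁
_° {X} {Y} Q b' b =
  ∀ (a' : 𝒫 Y) → IsAtom a' → a' ⊆ b' →
    Σ (𝒫 X) λ a → IsAtom a × a ⊆ b × Q a a'

IsBisimulatory : {X Y : Set} → Rel X 0ℓ → Rel Y 0ℓ → (𝒫 X → 𝒫 Y → Set) → Set₁
IsBisimulatory {X} {Y} R S Q =
  IsDirectionallyAtomic Q ×
  (∀ (A : 𝒫 X) (B : 𝒫 Y) → Q A (□ S B) → Q (◇⁻ R A) B) ×
  (∀ (B : 𝒫 Y) (A : 𝒫 X) → (Q °) B (□ R A) → (Q °) (◇⁻ S B) A)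

_≐_ : {X Y : Set} → (𝒫 X → 𝒫 Y → Set) → (𝒫 X → 𝒫 Y → Set) → Set₁
Q ≐ Q' = ∀ A B → Q A B ⇔ Q' A B

{-# OPTIONS --safe #-}

-- Classically, the atoms of 𝒫(X) are exactly the singletons, so a directionally
-- atomic Q is determined by the point relation T x y := Q ｛x｝ ｛y｝: atomic
-- foundedness gives Q ⊆ Low T and left disjunctivity (writing A as the join of
-- its singletons) gives Low T ⊆ Q. The two modal conditions, applied to the
-- singleton ｛x｝ with □_S (S y) and to ｛y｝ with □_R (R x), are then exactly
-- the forth and back conditions of a bisimulation for T.
module Submission where

open import Defs
open import Level using (0ℓ)
open import Data.Empty using (⊥-elim)
open import Data.Product using (Σ; _×_; _,_; proj₁; proj₂)
open import Data.Sum using (_⊎_; inj₁; inj₂)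
open import Function.Bundles using (mk⇔)
open import Relation.Binary.Core using (Rel; REL)
open import Relation.Binary.PropositionalEquality using (_≡_; refl; sym; subst)
open import Relation.Nullary using (yes; no)
open import Relation.Unary using (_⊆_; ｛_｝)
open import Axiom.ExcludedMiddle using (ExcludedMiddle)

pointRelation : {X Y : Set} → (𝒫 X → 𝒫 Y → Set) → REL X Y 0ℓ
pointRelation Q x y = Q ｛ x ｝ ｛ y ｝

module _ {X Y : Set} {Q : 𝒫 X → 𝒫 Y → Set} (bim : IsBimodule Q) where

  antitoneˡ : ∀ {p' p q} → p' ⊆ p → Q p q → Q p' q
  antitoneˡ p'⊆p Qpq = bim _ _ _ _ p'⊆p Qpq (λ z → z)

  monotoneʳ : ∀ {p q q'} → Q p q → q ⊆ q' → Q p q'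
  monotoneʳ Qpq q⊆q' = bim _ _ _ _ (λ z → z) Qpq q⊆q'

  Low-pointRelation⇒ : IsLeftDisjunctive Q →
                       ∀ {A B} → Low (pointRelation Q) A B → Q A B
  Low-pointRelation⇒ ldis {A} {B} low =
    antitoneˡ A⊆⋁singletons (ldis _ (λ a → ｛ proj₁ a ｝) B singleton-Q-B)
    where
    A⊆⋁singletons : A ⊆ ⋁ {I = Σ X A} (λ a → ｛ proj₁ a ｝)
    A⊆⋁singletons {x} Ax = (x , Ax) , refl

    singleton-Q-B : ((a , Aa) : Σ X A) → Q ｛ a ｝ B
    singleton-Q-B (a , Aa) with low a Aa
    ... | b , Bb , Tab = monotoneʳ Tab λ { refl → Bb }

module _ (em : ∀ {ℓ} → ExcludedMiddle ℓ) where

  singleton-isAtom : {X : Set} (x : X) → IsAtom ｛ x ｝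
  singleton-isAtom x = (λ empty → empty x refl) , below
    where
    below : ∀ b → b ⊆ ｛ x ｝ → IsBottom b ⊎ ｛ x ｝ ⊆ b
    below b b⊆x with em {P = b x}
    ... | yes bx = inj₂ λ { refl → bx }
    ... | no ¬bx = inj₁ λ z bz → ¬bx (subst b (sym (b⊆x bz)) bz)

  atom⇒singleton : {X : Set} {a : 𝒫 X} → IsAtom a → Σ X λ x → a x × a ⊆ ｛ x ｝
  atom⇒singleton {X} {a} (nonempty , minimal) with em {P = Σ X a}
  ... | no ¬inhabited = ⊥-elim (nonempty λ x ax → ¬inhabited (x , ax))
  ... | yes (x , ax) with minimal (λ z → x ≡ z × a z) proj₂
  ...   | inj₁ empty = ⊥-elim (empty x (refl , ax))
  ...   | inj₂ a⊆x = x , ax , λ az → proj₁ (a⊆x az)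

  module _ {X Y : Set} {Q : 𝒫 X → 𝒫 Y → Set} (bim : IsBimodule Q) where

    Low-pointRelation⇐ : IsAtomicFounded Q →
                         ∀ {A B} → Q A B → Low (pointRelation Q) A B
    Low-pointRelation⇐ af {B = B} QAB a Aa
      with af ｛ a ｝ B (singleton-isAtom a) (antitoneˡ bim (λ { refl → Aa }) QAB)
    ... | b' , b'-atom , b'⊆B , Qab' with atom⇒singleton b'-atom
    ...   | b , b'b , b'⊆b = b , b'⊆B b'b , monotoneʳ bim Qab' b'⊆b

    ≐-Low-pointRelation : IsLeftDisjunctive Q → IsAtomicFounded Q →
                          Q ≐ Low (pointRelation Q)
    ≐-Low-pointRelation ldis af A B =
      mk⇔ (Low-pointRelation⇐ af) (Low-pointRelation⇒ bim ldis)

    pointRelation-isSimulation :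
      {R : Rel X 0ℓ} {S : Rel Y 0ℓ} → IsAtomicFounded Q →
      (∀ A B → Q A (□ S B) → Q (◇⁻ R A) B) →
      IsSimulation R S (pointRelation Q)
    pointRelation-isSimulation {S = S} af forth x x' y Txy Rxx' =
      Low-pointRelation⇐ af Qx'Sy x' refl
      where
      Qx'Sy : Q ｛ x' ｝ (S y)
      Qx'Sy = antitoneˡ bim (λ { refl → x , refl , Rxx' })
                (forth ｛ x ｝ (S y) (monotoneʳ bim Txy λ { refl v Syv → Syv }))

    pointRelation⇒°-□ : {R : Rel X 0ℓ} {x : X} {y : Y} →
                        pointRelation Q x y → (Q °) ｛ y ｝ (□ R (R x))
    pointRelation⇒°-□ {x = x} Txy a' a'-atom a'⊆y with atom⇒singleton a'-atom
    ... | z , a'z , _ = ｛ x ｝ , singleton-isAtom x , (λ { refl v Rxv → Rxv })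
                      , monotoneʳ bim Txy λ { refl → subst a' (sym (a'⊆y a'z)) a'z }

    pointRelation-isCosimulation :
      {R : Rel X 0ℓ} {S : Rel Y 0ℓ} →
      (∀ B A → (Q °) B (□ R A) → (Q °) (◇⁻ S B) A) →
      IsCosimulation R S (pointRelation Q)
    pointRelation-isCosimulation {R} back y y' x Txy Syy'
      with back ｛ y ｝ (R x) (pointRelation⇒°-□ Txy) ｛ y' ｝ (singleton-isAtom y')
                (λ { refl → y , refl , Syy' })
    ... | a , a-atom , a⊆Rx , Qay' with atom⇒singleton a-atom
    ...   | x' , ax' , _ = x' , a⊆Rx ax' , antitoneˡ bim (λ { refl → ax' }) Qay'

mainTheorem17 : (em : ∀ {ℓ} → ExcludedMiddle ℓ) →
    (X Y : Set) (R : Rel X 0ℓ) (S : Rel Y 0ℓ) (Q : 𝒫 X → 𝒫 Y → Set) →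
    IsBisimulatory R S Q →
    Σ (REL X Y 0ℓ) λ T → IsBisimulation R S T × (Q ≐ Low T)
mainTheorem17 em X Y R S Q ((bim , ldis , af) , forth , back) =
  pointRelation Q
  , (pointRelation-isSimulation em bim af forth , pointRelation-isCosimulation em bim back)
  , ≐-Low-pointRelation em bim ldis af
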